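{- For all $g_1,g_2,g_3\in\tilde{\mathrm{CH}}_2$, one has $W_1(g_1,g_2,g_3)=S_{ -1}\big(W_0(g_1,g_2,g_3)\big)$.
   Context: Let $\mathrm{CH}_2$ be the commutative ring which is a free $\mathbb{Z}$-module with basis $\{h_i : i\ge 0\}$ and multiplication $h_ih_j=\sum_{k=0}^{\min(i,j)}h_{i+j-2k}$. Let $\tilde{\mathrm{CH}}_2$ be the free $\mathbb{Z}$-module with basis $\{\tilde h_i : i\in\mathbb{Z}\}$, with left $\mathrm{CH}_2$-action $h_i\tilde h_j=\sum_{k=0}^{i}\tilde h_{j-i+2k}$ ($i\ge0$), extended bilinearly. Let $L:\tilde{\mathrm{CH}}_2\to \mathrm{CH}_2$ be the $\mathbb{Z}$-linear map with $L(\tilde h_{ -1})=0$, $L(\tilde h_i)=h_i$ for $i\ge 0$, $L(\tilde h_i)=-h_{ -i-2}$ for $i\le -2$. The (associative, non-commutative) product on $\tilde{\mathrm{CH}}_2$ is $g_1g_2:=L(g_1)\,g_2$. For $i\in\mathbb{Z}$, $S_i$ is the $\mathbb{Z}$-linear map with $S_i(\tilde h_j)=\tilde h_{j+i}$. Define $W_0(g_1,g_2,g_3)=g_2\big(g_1g_3-S_{ -1}(g_1)S_{ -1}(g_3)\big)$ and $W_1(g_1,g_2,g_3)=S_{ -1}(g_1)g_2g_3+g_1g_2S_{ -1}(g_3)-S_{ -1}(g_1)\tilde h_1g_2S_{ -1}(g_3)$. -}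

module Defs where

open import Data.Nat using (ℕ; zero; suc)
open import Data.Integer as Z using (ℤ; +_; -[1+_]; _+_; _*_; -_; _-_)
open import Relation.Binary.PropositionalEquality using (_≡_)
open import Data.List using (List; []; _∷_; _++_; map; concatMap; upTo; foldr)
open import Data.Product using (_×_; _,_)
open import Relation.Nullary.Decidable using (does)
open import Data.Bool using (if_then_else_)

-- Elements of the free ℤ-modules are represented as finite formal sums:
-- lists of (coefficient , basis index). Two formal sums denote the same
-- element iff all their coefficients agree (see coeff / _≈̃_ below).

CH₂ : Set
CH₂ = List (ℤ × ℕ)

-- CH̃₂ : free ℤ-module on {h̃_i : i ∈ ℤ}
CHt : Set
CHt = List (ℤ × ℤ)

ht : ℤ → CHt
ht i = (+ 1 , i) ∷ []

scale : ℤ → CHt → CHt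
scale a = map (λ { (c , i) → (a * c , i) })

_-ₜ_ : CHt → CHt → CHt
x -ₜ y = x ++ scale (- (+ 1)) y

coeff : CHt → ℤ → ℤ
coeff [] n = + 0
coeff ((c , i) ∷ xs) n = (if does (i Z.≟ n) then c else + 0) + coeff xs n

_≈̃_ : CHt → CHt → Set
x ≈̃ y = ∀ n → coeff x n ≡ coeff y n

actBasis : ℕ → ℤ → CHt
actBasis i j = map (λ k → (+ 1 , (j - (+ i)) + (+ 2) * (+ k))) (upTo (suc i))

act : CH₂ → CHt → CHt
act x y = concatMap (λ { (a , i) → concatMap (λ { (b , j) → scale (a * b) (actBasis i j) }) y }) x

Lb : ℤ × ℤ → CH₂
Lb (c , + i) = (c , i) ∷ []
Lb (c , -[1+ zero ]) = []
Lb (c , -[1+ suc m ]) = (- c , m) ∷ []   -- h̃_{-(m+2)} ↦ -h_{m}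

L : CHt → CH₂
L = concatMap Lb

_·_ : CHt → CHt → CHt
g₁ · g₂ = act (L g₁) g₂
infixl 7 _·_

S : ℤ → CHt → CHt
S i = map (λ { (c , j) → (c , j + i) })

W₀ : CHt → CHt → CHt → CHt
W₀ g₁ g₂ g₃ = g₂ · ((g₁ · g₃) -ₜ (S (- (+ 1)) g₁ · S (- (+ 1)) g₃))

W₁ : CHt → CHt → CHt → CHt
W₁ g₁ g₂ g₃ =
  ((S (- (+ 1)) g₁ · g₂ · g₃) ++ (g₁ · g₂ · S (- (+ 1)) g₃))
    -ₜ (S (- (+ 1)) g₁ · ht (+ 1) · g₂ · S (- (+ 1)) g₃)

-- Identify a formal sum x with the functional φ ↦ ⟨ x ∣ φ ⟩ on test functions φ : ℤ → ℤ;
-- coefficients are its values at indicator functions, so it suffices to compare pairings.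
-- Left multiplication by g has a transpose g ·ᵀ_, and both sides pair to the same expression
-- once we know that these transposes commute, that (a b)ᵀ = bᵀ aᵀ, that they commute with
-- the translations Sᵀ, and that h̃₁ᵀ ψ = ψ (· - 1) + ψ (· + 1).  The first three reduce to
-- basis elements.  Every φ is a difference Δ Ψ, and on differences the action of h̃_p
-- telescopes: h̃_pᵀ (Δ Ψ) = Δ[ p ] Ψ, where Δ[ p ] Ψ q = Ψ (q + p) - Ψ (q - p - 2) and
-- Δ = Δ[ 0 ].  The operators Δ[ p ] visibly commute with each other and with translations.
module Submission where

open import Defs
open import Data.Bool using (if_then_else_; true; false)
open import Data.Integer using (ℤ; +_; -[1+_]; _+_; _-_; _*_; -_; _≟_; 1ℤ; -1ℤ)
open import Data.Integer.Properties
  using (+-identityˡ; +-identityʳ; *-identityˡ; *-identityʳ; *-zeroʳ; +-inverseʳ; -1*i≡-i)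
open import Data.Integer.Tactic.RingSolver using (solve; solve-∀)
open import Data.List using (List; []; _∷_; _++_; concatMap; applyUpTo)
open import Data.List.Properties using (map-upTo)
open import Data.Nat using (ℕ; zero; suc)
import Data.Nat.Properties as ℕₚ
open import Data.Product using (_×_; _,_)
open import Relation.Binary.PropositionalEquality
  using (_≡_; _≗_; refl; sym; trans; cong; cong₂; module ≡-Reasoning)
open import Relation.Nullary.Decidable using (does)
open ≡-Reasoning

private variable
  I J : Set

⟨_∣_⟩ : List (ℤ × I) → (I → ℤ) → ℤ
⟨ [] ∣ φ ⟩ = + 0
⟨ (c , a) ∷ x ∣ φ ⟩ = c * φ a + ⟨ x ∣ φ ⟩

pair-++ : (x y : List (ℤ × I)) (φ : I → ℤ) → ⟨ x ++ y ∣ φ ⟩ ≡ ⟨ x ∣ φ ⟩ + ⟨ y ∣ φ ⟩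
pair-++ [] y φ = sym (+-identityˡ _)
pair-++ ((c , a) ∷ x) y φ = begin
  c * φ a + ⟨ x ++ y ∣ φ ⟩          ≡⟨ cong (_+_ (c * φ a)) (pair-++ x y φ) ⟩
  c * φ a + (⟨ x ∣ φ ⟩ + ⟨ y ∣ φ ⟩) ≡⟨ assoc (c * φ a) _ _ ⟩
  c * φ a + ⟨ x ∣ φ ⟩ + ⟨ y ∣ φ ⟩   ∎
  where
  assoc : ∀ u v w → u + (v + w) ≡ u + v + w
  assoc = solve-∀

pair-scale : ∀ a (x : CHt) φ → ⟨ scale a x ∣ φ ⟩ ≡ a * ⟨ x ∣ φ ⟩
pair-scale a [] φ = sym (*-zeroʳ a)
pair-scale a ((c , i) ∷ x) φ =
  trans (cong (_+_ (a * c * φ i)) (pair-scale a x φ)) (distrib a c (φ i) ⟨ x ∣ φ ⟩)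
  where
  distrib : ∀ a c u v → a * c * u + a * v ≡ a * (c * u + v)
  distrib = solve-∀

pair--ₜ : ∀ (x y : CHt) φ → ⟨ x -ₜ y ∣ φ ⟩ ≡ ⟨ x ∣ φ ⟩ - ⟨ y ∣ φ ⟩
pair--ₜ x y φ =
  trans (pair-++ x _ φ) (cong (_+_ ⟨ x ∣ φ ⟩) (trans (pair-scale -1ℤ y φ) (-1*i≡-i ⟨ y ∣ φ ⟩)))

pair-cong : ∀ (x : List (ℤ × I)) {φ ψ} → φ ≗ ψ → ⟨ x ∣ φ ⟩ ≡ ⟨ x ∣ ψ ⟩
pair-cong [] φ≗ψ = refl
pair-cong ((c , a) ∷ x) φ≗ψ = cong₂ (λ u v → c * u + v) (φ≗ψ a) (pair-cong x φ≗ψ)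

pair-+ : ∀ (x : List (ℤ × I)) φ ψ → ⟨ x ∣ (λ a → φ a + ψ a) ⟩ ≡ ⟨ x ∣ φ ⟩ + ⟨ x ∣ ψ ⟩
pair-+ [] φ ψ = refl
pair-+ ((c , a) ∷ x) φ ψ =
  trans (cong (_+_ (c * (φ a + ψ a))) (pair-+ x φ ψ)) (distrib c (φ a) (ψ a) _ _)
  where
  distrib : ∀ c u v s t → c * (u + v) + (s + t) ≡ c * u + s + (c * v + t)
  distrib = solve-∀

pair-* : ∀ (x : List (ℤ × I)) b φ → ⟨ x ∣ (λ a → b * φ a) ⟩ ≡ b * ⟨ x ∣ φ ⟩
pair-* [] b φ = sym (*-zeroʳ b)
pair-* ((c , a) ∷ x) b φ =
  trans (cong (_+_ (c * (b * φ a))) (pair-* x b φ)) (distrib c b (φ a) _)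
  where
  distrib : ∀ c b u v → c * (b * u) + b * v ≡ b * (c * u + v)
  distrib = solve-∀

pair-0 : ∀ (x : List (ℤ × I)) → ⟨ x ∣ (λ _ → + 0) ⟩ ≡ + 0
pair-0 x = pair-* x (+ 0) (λ _ → + 0)

pair-neg : ∀ (x : List (ℤ × I)) φ → ⟨ x ∣ (λ a → - φ a) ⟩ ≡ - ⟨ x ∣ φ ⟩
pair-neg x φ = begin
  ⟨ x ∣ (λ a → - φ a) ⟩         ≡⟨ pair-cong x (λ a → sym (-1*i≡-i (φ a))) ⟩
  ⟨ x ∣ (λ a → -1ℤ * φ a) ⟩    ≡⟨ pair-* x -1ℤ φ ⟩
  -1ℤ * ⟨ x ∣ φ ⟩               ≡⟨ -1*i≡-i _ ⟩
  - ⟨ x ∣ φ ⟩                   ∎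

pair-swap : ∀ (x : List (ℤ × I)) (y : List (ℤ × J)) (F : I → J → ℤ) →
  ⟨ x ∣ (λ a → ⟨ y ∣ F a ⟩) ⟩ ≡ ⟨ y ∣ (λ b → ⟨ x ∣ (λ a → F a b) ⟩) ⟩
pair-swap [] y F = sym (pair-0 y)
pair-swap ((c , a) ∷ x) y F = begin
  c * ⟨ y ∣ F a ⟩ + ⟨ x ∣ (λ a → ⟨ y ∣ F a ⟩) ⟩
    ≡⟨ cong₂ _+_ (sym (pair-* y c (F a))) (pair-swap x y F) ⟩
  ⟨ y ∣ (λ b → c * F a b) ⟩ + ⟨ y ∣ (λ b → ⟨ x ∣ (λ a → F a b) ⟩) ⟩
    ≡⟨ sym (pair-+ y _ _) ⟩
  ⟨ y ∣ (λ b → c * F a b + ⟨ x ∣ (λ a → F a b) ⟩) ⟩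
    ∎

pair-concatMap : ∀ (f : ℤ × I → List (ℤ × J)) (x : List (ℤ × I)) {φ G} →
  (∀ c a → ⟨ f (c , a) ∣ φ ⟩ ≡ c * G a) → ⟨ concatMap f x ∣ φ ⟩ ≡ ⟨ x ∣ G ⟩
pair-concatMap f [] hf = refl
pair-concatMap f ((c , a) ∷ x) {φ} hf =
  trans (pair-++ (f (c , a)) (concatMap f x) φ) (cong₂ _+_ (hf c a) (pair-concatMap f x hf))

δ : ℤ → ℤ → ℤ
δ n j = if does (j ≟ n) then + 1 else + 0

coeff-pair : ∀ x n → coeff x n ≡ ⟨ x ∣ δ n ⟩
coeff-pair [] n = refl
coeff-pair ((c , i) ∷ x) n with does (i ≟ n)
... | true  = cong₂ _+_ (sym (*-identityʳ c)) (coeff-pair x n)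
... | false = cong₂ _+_ (sym (*-zeroʳ c)) (coeff-pair x n)

Sᵀ : ℤ → (ℤ → ℤ) → ℤ → ℤ
Sᵀ s φ j = φ (j + s)

pair-S : ∀ s x φ → ⟨ S s x ∣ φ ⟩ ≡ ⟨ x ∣ Sᵀ s φ ⟩
pair-S s [] φ = refl
pair-S s ((c , j) ∷ x) φ = cong (_+_ (c * φ (j + s))) (pair-S s x φ)

-- Transposes of L, of the action and of the product

Lᵀ : (ℕ → ℤ) → ℤ → ℤ
Lᵀ F (+ i) = F i
Lᵀ F -[1+ zero ] = + 0
Lᵀ F -[1+ suc m ] = - F m

Lᵀ-cong : ∀ {F G} → F ≗ G → ∀ p → Lᵀ F p ≡ Lᵀ G p
Lᵀ-cong F≗G (+ i) = F≗G i
Lᵀ-cong F≗G -[1+ zero ] = refl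
Lᵀ-cong F≗G -[1+ suc m ] = cong -_ (F≗G m)

Lᵀ-pair : ∀ (y : CHt) (F : ℕ → ℤ → ℤ) p →
  Lᵀ (λ i → ⟨ y ∣ F i ⟩) p ≡ ⟨ y ∣ (λ j → Lᵀ (λ i → F i j) p) ⟩
Lᵀ-pair y F (+ i) = refl
Lᵀ-pair y F -[1+ zero ] = sym (pair-0 y)
Lᵀ-pair y F -[1+ suc m ] = sym (pair-neg y (F m))

pair-L : ∀ g F → ⟨ L g ∣ F ⟩ ≡ ⟨ g ∣ Lᵀ F ⟩
pair-L g F = pair-concatMap Lb g pair-Lb
  where
  pair-Lb : ∀ c p → ⟨ Lb (c , p) ∣ F ⟩ ≡ c * Lᵀ F p
  pair-Lb c (+ i) = +-identityʳ _
  pair-Lb c -[1+ zero ] = sym (*-zeroʳ c)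
  pair-Lb c -[1+ suc m ] = trans (+-identityʳ _) (neg-swap c (F m))
    where
    neg-swap : ∀ c u → - c * u ≡ c * - u
    neg-swap = solve-∀

pair-act : ∀ x y φ → ⟨ act x y ∣ φ ⟩ ≡ ⟨ y ∣ (λ j → ⟨ x ∣ (λ i → ⟨ actBasis i j ∣ φ ⟩) ⟩) ⟩
pair-act x y φ = trans (pair-concatMap _ x pair-row) (pair-swap x y _)
  where
  pair-row : ∀ a i → ⟨ concatMap (λ { (b , j) → scale (a * b) (actBasis i j) }) y ∣ φ ⟩
                     ≡ a * ⟨ y ∣ (λ j → ⟨ actBasis i j ∣ φ ⟩) ⟩
  pair-row a i = trans (pair-concatMap _ y entry) (pair-* y a _)
    where
    rearrange : ∀ a b t → a * b * t ≡ b * (a * t)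
    rearrange = solve-∀
    entry : ∀ b j → ⟨ scale (a * b) (actBasis i j) ∣ φ ⟩ ≡ b * (a * ⟨ actBasis i j ∣ φ ⟩)
    entry b j = trans (pair-scale (a * b) (actBasis i j) φ) (rearrange a b _)

-- basisᵀ p φ j = ⟨ h̃_p h̃_j ∣ φ ⟩
basisᵀ : ℤ → (ℤ → ℤ) → ℤ → ℤ
basisᵀ p φ j = Lᵀ (λ i → ⟨ actBasis i j ∣ φ ⟩) p

infixr 7 _·ᵀ_

_·ᵀ_ : CHt → (ℤ → ℤ) → ℤ → ℤ
(g ·ᵀ φ) j = ⟨ g ∣ (λ p → basisᵀ p φ j) ⟩

pair-· : ∀ g y φ → ⟨ g · y ∣ φ ⟩ ≡ ⟨ y ∣ g ·ᵀ φ ⟩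
pair-· g y φ = trans (pair-act (L g) y φ) (pair-cong y (λ j → pair-L g _))

basisᵀ-cong : ∀ p {φ ψ} → φ ≗ ψ → basisᵀ p φ ≗ basisᵀ p ψ
basisᵀ-cong p φ≗ψ j = Lᵀ-cong (λ i → pair-cong (actBasis i j) φ≗ψ) p

basisᵀ-pair : ∀ p (y : CHt) (G : ℤ → ℤ → ℤ) j →
  basisᵀ p (λ t → ⟨ y ∣ (λ m → G m t) ⟩) j ≡ ⟨ y ∣ (λ m → basisᵀ p (G m) j) ⟩
basisᵀ-pair p y G j =
  trans (Lᵀ-cong (λ i → pair-swap (actBasis i j) y _) p) (Lᵀ-pair y _ p)

-- Generalised differences

Δ[_] : ℤ → (ℤ → ℤ) → ℤ → ℤ
Δ[ p ] Ψ q = Ψ (q + p) - Ψ ((q - p) - + 2)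

Δ : (ℤ → ℤ) → ℤ → ℤ
Δ = Δ[ + 0 ]

Δ[]-comm : ∀ p q Θ → Δ[ p ] (Δ[ q ] Θ) ≗ Δ[ q ] (Δ[ p ] Θ)
Δ[]-comm p q Θ j = begin
  (Θ ((j + p) + q) - Θ (((j + p) - q) - + 2))
    - (Θ (((j - p) - + 2) + q) - Θ ((((j - p) - + 2) - q) - + 2))
    ≡⟨ cong₂ _-_ (cong₂ _-_ (cong Θ (solve (j ∷ p ∷ q ∷ []))) (cong Θ (solve (j ∷ p ∷ q ∷ []))))
                 (cong₂ _-_ (cong Θ (solve (j ∷ p ∷ q ∷ []))) (cong Θ (solve (j ∷ p ∷ q ∷ [])))) ⟩
  (Θ ((j + q) + p) - Θ (((j - q) - + 2) + p))
    - (Θ (((j + q) - p) - + 2) - Θ ((((j - q) - + 2) - p) - + 2))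
    ≡⟨ swap-middle (Θ ((j + q) + p)) (Θ (((j - q) - + 2) + p))
                   (Θ (((j + q) - p) - + 2)) (Θ ((((j - q) - + 2) - p) - + 2)) ⟩
  (Θ ((j + q) + p) - Θ (((j + q) - p) - + 2))
    - (Θ (((j - q) - + 2) + p) - Θ ((((j - q) - + 2) - p) - + 2))
    ∎
  where
  swap-middle : ∀ a b c d → (a - b) - (c - d) ≡ (a - c) - (b - d)
  swap-middle = solve-∀

Δ[]-Sᵀ : ∀ p s Ψ → Δ[ p ] (Sᵀ s Ψ) ≗ Sᵀ s (Δ[ p ] Ψ)
Δ[]-Sᵀ p s Ψ q =
  cong₂ _-_ (cong Ψ (solve (q ∷ p ∷ s ∷ []))) (cong Ψ (solve (q ∷ p ∷ s ∷ [])))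

-- Read as a function of p, the value Δ (Δ[ p ] Θ) j is again a difference.
mirror : (ℤ → ℤ) → ℤ → ℤ → ℤ
mirror Θ j m = Θ (j + m) + Θ ((j - m) - + 4)

Δ-Δ[]-mirror : ∀ m Θ j → Δ (Δ[ m ] Θ) j ≡ Δ (mirror Θ j) m
Δ-Δ[]-mirror m Θ j = begin
  (Θ ((j + + 0) + m) - Θ (((j + + 0) - m) - + 2))
    - (Θ (((j - + 0) - + 2) + m) - Θ ((((j - + 0) - + 2) - m) - + 2))
    ≡⟨ cong₂ _-_ (cong₂ _-_ (cong Θ (solve (j ∷ m ∷ []))) (cong Θ (solve (j ∷ m ∷ []))))
                 (cong₂ _-_ (cong Θ (solve (j ∷ m ∷ []))) (cong Θ (solve (j ∷ m ∷ [])))) ⟩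
  (Θ (j + (m + + 0)) - Θ ((j - ((m - + 0) - + 2)) - + 4))
    - (Θ (j + ((m - + 0) - + 2)) - Θ ((j - (m + + 0)) - + 4))
    ≡⟨ regroup (Θ (j + (m + + 0))) (Θ (j + ((m - + 0) - + 2)))
               (Θ ((j - ((m - + 0) - + 2)) - + 4)) (Θ ((j - (m + + 0)) - + 4)) ⟩
  Δ (mirror Θ j) m ∎
  where
  regroup : ∀ a b c d → (a - c) - (b - d) ≡ (a + d) - (b + c)
  regroup = solve-∀

Δ[]-mirror : ∀ p q Θ j → Δ[ p ] (mirror Θ j) q ≡ Δ[ q ] (Δ[ p ] Θ) j
Δ[]-mirror p q Θ j = begin
  (Θ (j + (q + p)) + Θ ((j - (q + p)) - + 4))
    - (Θ (j + ((q - p) - + 2)) + Θ ((j - ((q - p) - + 2)) - + 4))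
    ≡⟨ cong₂ _-_ (cong₂ _+_ (cong Θ (solve (j ∷ p ∷ q ∷ []))) (cong Θ (solve (j ∷ p ∷ q ∷ []))))
                 (cong₂ _+_ (cong Θ (solve (j ∷ p ∷ q ∷ []))) (cong Θ (solve (j ∷ p ∷ q ∷ [])))) ⟩
  (Θ ((j + q) + p) + Θ ((((j - q) - + 2) - p) - + 2))
    - (Θ (((j + q) - p) - + 2) + Θ (((j - q) - + 2) + p))
    ≡⟨ regroup (Θ ((j + q) + p)) (Θ (((j + q) - p) - + 2))
               (Θ (((j - q) - + 2) + p)) (Θ ((((j - q) - + 2) - p) - + 2)) ⟩
  Δ[ q ] (Δ[ p ] Θ) j ∎
  where
  regroup : ∀ a b c d → (a + d) - (b + c) ≡ (a - b) - (c - d)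
  regroup = solve-∀

antiΔ : (ℤ → ℤ) → ℤ → ℤ
antiΔ φ (+ n) = up n
  where
  up : ℕ → ℤ
  up zero = + 0
  up (suc zero) = + 0
  up (suc (suc n)) = up n + φ (+ suc (suc n))
antiΔ φ -[1+ n ] = down n
  where
  down : ℕ → ℤ
  down zero = - φ (+ 1)
  down (suc zero) = - φ (+ 0)
  down (suc (suc n)) = down n - φ -[1+ n ]

Δ-antiΔ : ∀ φ → Δ (antiΔ φ) ≗ φ
Δ-antiΔ φ m =
  trans (cong₂ _-_ (cong (antiΔ φ) (+-identityʳ m)) (cong (antiΔ φ) (two-back m))) (step m)
  where
  two-back : ∀ m → (m - + 0) - + 2 ≡ m - + 2
  two-back = solve-∀
  cancel₁ : ∀ a → + 0 - - a ≡ a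
  cancel₁ = solve-∀
  cancel₂ : ∀ a b → (a + b) - a ≡ b
  cancel₂ = solve-∀
  cancel₃ : ∀ a b → a - (a - b) ≡ b
  cancel₃ = solve-∀
  step : ∀ m → antiΔ φ m - antiΔ φ (m - + 2) ≡ φ m
  step (+ zero) = cancel₁ (φ (+ 0))
  step (+ suc zero) = cancel₁ (φ (+ 1))
  step (+ suc (suc n)) = cancel₂ (antiΔ φ (+ n)) (φ (+ suc (suc n)))
  step -[1+ n ] =
    trans (cong (λ k → antiΔ φ -[1+ n ] - antiΔ φ -[1+ suc k ]) (ℕₚ.+-comm n 1))
          (cancel₃ (antiΔ φ -[1+ n ]) (φ -[1+ n ]))

Δ²-antiΔ² : ∀ φ → φ ≗ Δ (Δ (antiΔ (antiΔ φ)))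
Δ²-antiΔ² φ m = trans (sym (Δ-antiΔ φ m))
  (cong₂ _-_ (sym (Δ-antiΔ (antiΔ φ) (m + + 0))) (sym (Δ-antiΔ (antiΔ φ) ((m - + 0) - + 2))))

-- The action of h̃_p on differences

pair-Δ-progression : ∀ Ψ n (e : ℕ → ℤ) → (∀ k → e (suc k) ≡ e k + + 2) →
  ⟨ applyUpTo (λ k → (+ 1 , e k)) (suc n) ∣ Δ Ψ ⟩ ≡ Ψ (e n + + 0) - Ψ ((e 0 - + 0) - + 2)
pair-Δ-progression Ψ zero e step = trans (+-identityʳ _) (*-identityˡ _)
pair-Δ-progression Ψ (suc n) e step = begin
  + 1 * Δ Ψ (e 0) + ⟨ applyUpTo (λ k → (+ 1 , e (suc k))) (suc n) ∣ Δ Ψ ⟩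
    ≡⟨ cong (_+_ (+ 1 * Δ Ψ (e 0))) (pair-Δ-progression Ψ n (λ k → e (suc k)) (λ k → step (suc k))) ⟩
  + 1 * Δ Ψ (e 0) + (Ψ (e (suc n) + + 0) - Ψ ((e 1 - + 0) - + 2))
    ≡⟨ cong (λ t → + 1 * Δ Ψ (e 0) + (Ψ (e (suc n) + + 0) - Ψ t))
            (trans (cong (λ t → (t - + 0) - + 2) (step 0)) (back (e 0))) ⟩
  + 1 * (Ψ (e 0 + + 0) - Ψ ((e 0 - + 0) - + 2)) + (Ψ (e (suc n) + + 0) - Ψ (e 0 + + 0))
    ≡⟨ telescope (Ψ (e 0 + + 0)) (Ψ ((e 0 - + 0) - + 2)) (Ψ (e (suc n) + + 0)) ⟩
  Ψ (e (suc n) + + 0) - Ψ ((e 0 - + 0) - + 2)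
    ∎
  where
  back : ∀ x → ((x + + 2) - + 0) - + 2 ≡ x + + 0
  back = solve-∀
  telescope : ∀ a b c → + 1 * (a - b) + (c - a) ≡ c - b
  telescope = solve-∀

basisᵀ-Δ : ∀ {φ} Ψ → φ ≗ Δ Ψ → ∀ p → basisᵀ p φ ≗ Δ[ p ] Ψ
basisᵀ-Δ {φ} Ψ φ≗ΔΨ (+ i) q = begin
  ⟨ actBasis i q ∣ φ ⟩
    ≡⟨ pair-cong (actBasis i q) φ≗ΔΨ ⟩
  ⟨ actBasis i q ∣ Δ Ψ ⟩
    ≡⟨ cong ⟨_∣ Δ Ψ ⟩ (map-upTo (λ k → (+ 1 , (q - + i) + + 2 * + k)) (suc i)) ⟩
  ⟨ applyUpTo (λ k → (+ 1 , (q - + i) + + 2 * + k)) (suc i) ∣ Δ Ψ ⟩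
    ≡⟨ pair-Δ-progression Ψ i (λ k → (q - + i) + + 2 * + k) (λ k → step q (+ i) (+ k)) ⟩
  Ψ (((q - + i) + + 2 * + i) + + 0) - Ψ ((((q - + i) + + 2 * + 0) - + 0) - + 2)
    ≡⟨ cong₂ _-_ (cong Ψ (top q (+ i))) (cong Ψ (bottom q (+ i))) ⟩
  Ψ (q + + i) - Ψ ((q - + i) - + 2)
    ∎
  where
  step : ∀ q x k → (q - x) + + 2 * (+ 1 + k) ≡ ((q - x) + + 2 * k) + + 2
  step = solve-∀
  top : ∀ q x → ((q - x) + + 2 * x) + + 0 ≡ q + x
  top = solve-∀
  bottom : ∀ q x → (((q - x) + + 2 * + 0) - + 0) - + 2 ≡ (q - x) - + 2
  bottom = solve-∀
basisᵀ-Δ Ψ _ -[1+ zero ] q =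
  sym (trans (cong (λ t → Ψ (q + -1ℤ) - Ψ t) (reflect q)) (+-inverseʳ (Ψ (q + -1ℤ))))
  where
  reflect : ∀ q → (q - -1ℤ) - + 2 ≡ q + -1ℤ
  reflect = solve-∀
basisᵀ-Δ {φ} Ψ φ≗ΔΨ -[1+ suc m ] q = begin
  - ⟨ actBasis m q ∣ φ ⟩              ≡⟨ cong -_ (basisᵀ-Δ Ψ φ≗ΔΨ (+ m) q) ⟩
  - (Ψ (q + + m) - Ψ ((q - + m) - + 2)) ≡⟨ negate (Ψ (q + + m)) (Ψ ((q - + m) - + 2)) ⟩
  Ψ ((q - + m) - + 2) - Ψ (q + + m)    ≡⟨ cong₂ _-_ (cong Ψ (left q (+ m))) (cong Ψ (right q (+ m))) ⟩
  Ψ (q + - (+ 2 + + m)) - Ψ ((q - - (+ 2 + + m)) - + 2) ∎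
  where
  negate : ∀ a b → - (a - b) ≡ b - a
  negate = solve-∀
  -- -[1+ suc m ] is definitionally - (+ 2 + + m), a form the solver can read.
  left : ∀ q x → (q - x) - + 2 ≡ q + - (+ 2 + x)
  left = solve-∀
  right : ∀ q x → q + x ≡ (q - - (+ 2 + x)) - + 2
  right = solve-∀

basisᵀ-Δ² : ∀ {φ} Θ → φ ≗ Δ (Δ Θ) → ∀ p → basisᵀ p φ ≗ Δ (Δ[ p ] Θ)
basisᵀ-Δ² Θ φ≗Δ²Θ p q = trans (basisᵀ-Δ (Δ Θ) φ≗Δ²Θ p q) (Δ[]-comm p (+ 0) Θ q)

basisᵀ-twice : ∀ {φ} Θ → φ ≗ Δ (Δ Θ) → ∀ p q → basisᵀ q (basisᵀ p φ) ≗ Δ[ q ] (Δ[ p ] Θ)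
basisᵀ-twice Θ φ≗Δ²Θ p = basisᵀ-Δ (Δ[ p ] Θ) (basisᵀ-Δ² Θ φ≗Δ²Θ p)

basisᵀ-comm : ∀ p q φ → basisᵀ p (basisᵀ q φ) ≗ basisᵀ q (basisᵀ p φ)
basisᵀ-comm p q φ j = begin
  basisᵀ p (basisᵀ q φ) j ≡⟨ basisᵀ-twice Θ φ≗Δ²Θ q p j ⟩
  Δ[ p ] (Δ[ q ] Θ) j     ≡⟨ Δ[]-comm p q Θ j ⟩
  Δ[ q ] (Δ[ p ] Θ) j     ≡⟨ sym (basisᵀ-twice Θ φ≗Δ²Θ p q j) ⟩
  basisᵀ q (basisᵀ p φ) j ∎
  where
  Θ : ℤ → ℤ
  Θ = antiΔ (antiΔ φ)
  φ≗Δ²Θ : φ ≗ Δ (Δ Θ)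
  φ≗Δ²Θ = Δ²-antiΔ² φ

-- Associativity (h̃_p h̃_q) h̃_j = h̃_p (h̃_q h̃_j), paired with φ.
basisᵀ-assoc : ∀ p q φ j → basisᵀ p (λ m → basisᵀ m φ j) q ≡ basisᵀ q (basisᵀ p φ) j
basisᵀ-assoc p q φ j = begin
  basisᵀ p (λ m → basisᵀ m φ j) q ≡⟨ basisᵀ-Δ (mirror Θ j) as-Δ p q ⟩
  Δ[ p ] (mirror Θ j) q           ≡⟨ Δ[]-mirror p q Θ j ⟩
  Δ[ q ] (Δ[ p ] Θ) j             ≡⟨ sym (basisᵀ-twice Θ φ≗Δ²Θ p q j) ⟩
  basisᵀ q (basisᵀ p φ) j         ∎
  where
  Θ : ℤ → ℤ
  Θ = antiΔ (antiΔ φ)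
  φ≗Δ²Θ : φ ≗ Δ (Δ Θ)
  φ≗Δ²Θ = Δ²-antiΔ² φ
  as-Δ : (λ m → basisᵀ m φ j) ≗ Δ (mirror Θ j)
  as-Δ m = trans (basisᵀ-Δ² Θ φ≗Δ²Θ m j) (Δ-Δ[]-mirror m Θ j)

basisᵀ-Sᵀ : ∀ p s φ → basisᵀ p (Sᵀ s φ) ≗ Sᵀ s (basisᵀ p φ)
basisᵀ-Sᵀ p s φ q = begin
  basisᵀ p (Sᵀ s φ) q ≡⟨ basisᵀ-Δ (Sᵀ s Ψ) Sᵀφ≗ΔSᵀΨ p q ⟩
  Δ[ p ] (Sᵀ s Ψ) q   ≡⟨ Δ[]-Sᵀ p s Ψ q ⟩
  Δ[ p ] Ψ (q + s)    ≡⟨ sym (basisᵀ-Δ Ψ φ≗ΔΨ p (q + s)) ⟩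
  basisᵀ p φ (q + s)  ∎
  where
  Ψ : ℤ → ℤ
  Ψ = antiΔ φ
  φ≗ΔΨ : φ ≗ Δ Ψ
  φ≗ΔΨ m = sym (Δ-antiΔ φ m)
  Sᵀφ≗ΔSᵀΨ : Sᵀ s φ ≗ Δ (Sᵀ s Ψ)
  Sᵀφ≗ΔSᵀΨ t = trans (φ≗ΔΨ (t + s)) (sym (Δ[]-Sᵀ (+ 0) s Ψ t))

·ᵀ-cong : ∀ g {φ ψ} → φ ≗ ψ → g ·ᵀ φ ≗ g ·ᵀ ψ
·ᵀ-cong g φ≗ψ j = pair-cong g (λ p → basisᵀ-cong p φ≗ψ j)

·ᵀ-·ᵀ : ∀ a b φ j → (a ·ᵀ b ·ᵀ φ) j ≡ ⟨ a ∣ (λ p → ⟨ b ∣ (λ q → basisᵀ p (basisᵀ q φ) j) ⟩) ⟩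
·ᵀ-·ᵀ a b φ j = pair-cong a (λ p → basisᵀ-pair p b (λ q → basisᵀ q φ) j)

·ᵀ-comm : ∀ a b φ → a ·ᵀ b ·ᵀ φ ≗ b ·ᵀ a ·ᵀ φ
·ᵀ-comm a b φ j = begin
  (a ·ᵀ b ·ᵀ φ) j                                          ≡⟨ ·ᵀ-·ᵀ a b φ j ⟩
  ⟨ a ∣ (λ p → ⟨ b ∣ (λ q → basisᵀ p (basisᵀ q φ) j) ⟩) ⟩ ≡⟨ pair-swap a b _ ⟩
  ⟨ b ∣ (λ q → ⟨ a ∣ (λ p → basisᵀ p (basisᵀ q φ) j) ⟩) ⟩
    ≡⟨ pair-cong b (λ q → pair-cong a (λ p → basisᵀ-comm p q φ j)) ⟩
  ⟨ b ∣ (λ q → ⟨ a ∣ (λ p → basisᵀ q (basisᵀ p φ) j) ⟩) ⟩ ≡⟨ sym (·ᵀ-·ᵀ b a φ j) ⟩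
  (b ·ᵀ a ·ᵀ φ) j                                          ∎

·ᵀ-assoc : ∀ a b φ → (a · b) ·ᵀ φ ≗ b ·ᵀ a ·ᵀ φ
·ᵀ-assoc a b φ j = begin
  ⟨ a · b ∣ (λ m → basisᵀ m φ j) ⟩                         ≡⟨ pair-· a b _ ⟩
  ⟨ b ∣ a ·ᵀ (λ m → basisᵀ m φ j) ⟩
    ≡⟨ pair-cong b (λ q → pair-cong a (λ p → basisᵀ-assoc p q φ j)) ⟩
  ⟨ b ∣ (λ q → ⟨ a ∣ (λ p → basisᵀ q (basisᵀ p φ) j) ⟩) ⟩ ≡⟨ sym (·ᵀ-·ᵀ b a φ j) ⟩
  (b ·ᵀ a ·ᵀ φ) j                                          ∎

·ᵀ-Sᵀ : ∀ g s φ → g ·ᵀ Sᵀ s φ ≗ Sᵀ s (g ·ᵀ φ)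
·ᵀ-Sᵀ g s φ j = pair-cong g (λ p → basisᵀ-Sᵀ p s φ j)

·ᵀ-·ᵀ-Sᵀ : ∀ a b s φ → a ·ᵀ b ·ᵀ Sᵀ s φ ≗ Sᵀ s (b ·ᵀ a ·ᵀ φ)
·ᵀ-·ᵀ-Sᵀ a b s φ j = begin
  (a ·ᵀ b ·ᵀ Sᵀ s φ) j    ≡⟨ ·ᵀ-cong a (·ᵀ-Sᵀ b s φ) j ⟩
  (a ·ᵀ Sᵀ s (b ·ᵀ φ)) j  ≡⟨ ·ᵀ-Sᵀ a s (b ·ᵀ φ) j ⟩
  (a ·ᵀ b ·ᵀ φ) (j + s)   ≡⟨ ·ᵀ-comm a b φ (j + s) ⟩
  (b ·ᵀ a ·ᵀ φ) (j + s)   ∎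

h̃₁·ᵀ : ∀ ψ → ht 1ℤ ·ᵀ ψ ≗ (λ j → Sᵀ -1ℤ ψ j + Sᵀ 1ℤ ψ j)
h̃₁·ᵀ ψ j = begin
  + 1 * (+ 1 * ψ ((j - + 1) + + 2 * + 0) + (+ 1 * ψ ((j - + 1) + + 2 * + 1) + + 0)) + + 0
    ≡⟨ unit (ψ ((j - + 1) + + 2 * + 0)) (ψ ((j - + 1) + + 2 * + 1)) ⟩
  ψ ((j - + 1) + + 2 * + 0) + ψ ((j - + 1) + + 2 * + 1)
    ≡⟨ cong₂ _+_ (cong ψ (solve (j ∷ []))) (cong ψ (solve (j ∷ []))) ⟩
  ψ (j + -1ℤ) + ψ (j + 1ℤ) ∎
  where
  unit : ∀ a b → + 1 * (+ 1 * a + (+ 1 * b + + 0)) + + 0 ≡ a + b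
  unit = solve-∀

pair-·-S : ∀ a s b φ → ⟨ a · S s b ∣ φ ⟩ ≡ ⟨ b ∣ Sᵀ s (a ·ᵀ φ) ⟩
pair-·-S a s b φ = trans (pair-· a (S s b) φ) (pair-S s b _)

pair-W₁ : ∀ g₁ g₂ g₃ φ → ⟨ W₁ g₁ g₂ g₃ ∣ φ ⟩ ≡
  ⟨ g₃ ∣ Sᵀ -1ℤ (g₂ ·ᵀ g₁ ·ᵀ φ) ⟩ - ⟨ g₃ ∣ Sᵀ -1ℤ (Sᵀ -1ℤ (g₂ ·ᵀ S -1ℤ g₁ ·ᵀ φ)) ⟩
pair-W₁ g₁ g₂ g₃ φ = begin
  ⟨ (X ++ Y) -ₜ Z ∣ φ ⟩
    ≡⟨ pair--ₜ (X ++ Y) Z φ ⟩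
  ⟨ X ++ Y ∣ φ ⟩ - ⟨ Z ∣ φ ⟩
    ≡⟨ cong₂ _-_ (trans (pair-++ X Y φ) (cong₂ _+_ pair-X pair-Y)) pair-Z ⟩
  (⟨ g₃ ∣ C ⟩ + ⟨ g₃ ∣ Sᵀ -1ℤ B ⟩) - (⟨ g₃ ∣ Sᵀ -1ℤ (Sᵀ -1ℤ C) ⟩ + ⟨ g₃ ∣ C ⟩)
    ≡⟨ cancel ⟨ g₃ ∣ C ⟩ ⟨ g₃ ∣ Sᵀ -1ℤ B ⟩ ⟨ g₃ ∣ Sᵀ -1ℤ (Sᵀ -1ℤ C) ⟩ ⟩
  ⟨ g₃ ∣ Sᵀ -1ℤ B ⟩ - ⟨ g₃ ∣ Sᵀ -1ℤ (Sᵀ -1ℤ C) ⟩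
    ∎
  where
  X Y Z : CHt
  X = (S -1ℤ g₁ · g₂) · g₃
  Y = (g₁ · g₂) · S -1ℤ g₃
  Z = ((S -1ℤ g₁ · ht 1ℤ) · g₂) · S -1ℤ g₃
  B C : ℤ → ℤ
  B = g₂ ·ᵀ g₁ ·ᵀ φ
  C = g₂ ·ᵀ S -1ℤ g₁ ·ᵀ φ
  cancel : ∀ c b d → (c + b) - (d + c) ≡ b - d
  cancel = solve-∀
  back-forth : ∀ j → (j + -1ℤ) + 1ℤ ≡ j
  back-forth = solve-∀
  pair-X : ⟨ X ∣ φ ⟩ ≡ ⟨ g₃ ∣ C ⟩
  pair-X = trans (pair-· (S -1ℤ g₁ · g₂) g₃ φ) (pair-cong g₃ (·ᵀ-assoc (S -1ℤ g₁) g₂ φ))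
  pair-Y : ⟨ Y ∣ φ ⟩ ≡ ⟨ g₃ ∣ Sᵀ -1ℤ B ⟩
  pair-Y = trans (pair-·-S (g₁ · g₂) -1ℤ g₃ φ) (pair-cong g₃ (λ j → ·ᵀ-assoc g₁ g₂ φ (j + -1ℤ)))
  Z-kernel : ((S -1ℤ g₁ · ht 1ℤ) · g₂) ·ᵀ φ ≗ (λ t → Sᵀ -1ℤ C t + Sᵀ 1ℤ C t)
  Z-kernel t = begin
    (((S -1ℤ g₁ · ht 1ℤ) · g₂) ·ᵀ φ) t    ≡⟨ ·ᵀ-assoc (S -1ℤ g₁ · ht 1ℤ) g₂ φ t ⟩
    (g₂ ·ᵀ (S -1ℤ g₁ · ht 1ℤ) ·ᵀ φ) t     ≡⟨ ·ᵀ-cong g₂ (·ᵀ-assoc (S -1ℤ g₁) (ht 1ℤ) φ) t ⟩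
    (g₂ ·ᵀ ht 1ℤ ·ᵀ S -1ℤ g₁ ·ᵀ φ) t      ≡⟨ ·ᵀ-comm g₂ (ht 1ℤ) (S -1ℤ g₁ ·ᵀ φ) t ⟩
    (ht 1ℤ ·ᵀ C) t                        ≡⟨ h̃₁·ᵀ C t ⟩
    Sᵀ -1ℤ C t + Sᵀ 1ℤ C t                ∎
  pair-Z : ⟨ Z ∣ φ ⟩ ≡ ⟨ g₃ ∣ Sᵀ -1ℤ (Sᵀ -1ℤ C) ⟩ + ⟨ g₃ ∣ C ⟩
  pair-Z = begin
    ⟨ Z ∣ φ ⟩
      ≡⟨ pair-·-S ((S -1ℤ g₁ · ht 1ℤ) · g₂) -1ℤ g₃ φ ⟩
    ⟨ g₃ ∣ Sᵀ -1ℤ (((S -1ℤ g₁ · ht 1ℤ) · g₂) ·ᵀ φ) ⟩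
      ≡⟨ pair-cong g₃ (λ j → Z-kernel (j + -1ℤ)) ⟩
    ⟨ g₃ ∣ (λ j → Sᵀ -1ℤ (Sᵀ -1ℤ C) j + C ((j + -1ℤ) + 1ℤ)) ⟩
      ≡⟨ pair-+ g₃ (Sᵀ -1ℤ (Sᵀ -1ℤ C)) (λ j → C ((j + -1ℤ) + 1ℤ)) ⟩
    ⟨ g₃ ∣ Sᵀ -1ℤ (Sᵀ -1ℤ C) ⟩ + ⟨ g₃ ∣ (λ j → C ((j + -1ℤ) + 1ℤ)) ⟩
      ≡⟨ cong (_+_ ⟨ g₃ ∣ Sᵀ -1ℤ (Sᵀ -1ℤ C) ⟩) (pair-cong g₃ (λ j → cong C (back-forth j))) ⟩
    ⟨ g₃ ∣ Sᵀ -1ℤ (Sᵀ -1ℤ C) ⟩ + ⟨ g₃ ∣ C ⟩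
      ∎

pair-S-W₀ : ∀ g₁ g₂ g₃ φ → ⟨ S -1ℤ (W₀ g₁ g₂ g₃) ∣ φ ⟩ ≡
  ⟨ g₃ ∣ Sᵀ -1ℤ (g₂ ·ᵀ g₁ ·ᵀ φ) ⟩ - ⟨ g₃ ∣ Sᵀ -1ℤ (Sᵀ -1ℤ (g₂ ·ᵀ S -1ℤ g₁ ·ᵀ φ)) ⟩
pair-S-W₀ g₁ g₂ g₃ φ = begin
  ⟨ S -1ℤ (g₂ · ((g₁ · g₃) -ₜ (S -1ℤ g₁ · S -1ℤ g₃))) ∣ φ ⟩
    ≡⟨ pair-S -1ℤ (W₀ g₁ g₂ g₃) φ ⟩
  ⟨ g₂ · ((g₁ · g₃) -ₜ (S -1ℤ g₁ · S -1ℤ g₃)) ∣ Sᵀ -1ℤ φ ⟩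
    ≡⟨ pair-· g₂ ((g₁ · g₃) -ₜ (S -1ℤ g₁ · S -1ℤ g₃)) (Sᵀ -1ℤ φ) ⟩
  ⟨ (g₁ · g₃) -ₜ (S -1ℤ g₁ · S -1ℤ g₃) ∣ ψ ⟩
    ≡⟨ pair--ₜ (g₁ · g₃) (S -1ℤ g₁ · S -1ℤ g₃) ψ ⟩
  ⟨ g₁ · g₃ ∣ ψ ⟩ - ⟨ S -1ℤ g₁ · S -1ℤ g₃ ∣ ψ ⟩
    ≡⟨ cong₂ _-_ (trans (pair-· g₁ g₃ ψ) (pair-cong g₃ (·ᵀ-·ᵀ-Sᵀ g₁ g₂ -1ℤ φ)))
                 (trans (pair-·-S (S -1ℤ g₁) -1ℤ g₃ ψ)
                        (pair-cong g₃ (λ j → ·ᵀ-·ᵀ-Sᵀ (S -1ℤ g₁) g₂ -1ℤ φ (j + -1ℤ)))) ⟩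
  ⟨ g₃ ∣ Sᵀ -1ℤ (g₂ ·ᵀ g₁ ·ᵀ φ) ⟩ - ⟨ g₃ ∣ Sᵀ -1ℤ (Sᵀ -1ℤ (g₂ ·ᵀ S -1ℤ g₁ ·ᵀ φ)) ⟩
    ∎
  where
  ψ : ℤ → ℤ
  ψ = g₂ ·ᵀ Sᵀ -1ℤ φ

theorem1 : (g₁ g₂ g₃ : CHt) → W₁ g₁ g₂ g₃ ≈̃ S (- (+ 1)) (W₀ g₁ g₂ g₃)
theorem1 g₁ g₂ g₃ n = begin
  coeff (W₁ g₁ g₂ g₃) n                ≡⟨ coeff-pair (W₁ g₁ g₂ g₃) n ⟩
  ⟨ W₁ g₁ g₂ g₃ ∣ δ n ⟩                ≡⟨ pair-W₁ g₁ g₂ g₃ (δ n) ⟩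
  _                                    ≡⟨ sym (pair-S-W₀ g₁ g₂ g₃ (δ n)) ⟩
  ⟨ S -1ℤ (W₀ g₁ g₂ g₃) ∣ δ n ⟩        ≡⟨ sym (coeff-pair (S -1ℤ (W₀ g₁ g₂ g₃)) n) ⟩
  coeff (S -1ℤ (W₀ g₁ g₂ g₃)) n        ∎
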